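{- Let $Q$ be a quasi-order. Then $Q$ is a well-quasi-order if and only if every sequence $(D_{n})_{n\in\omega}$ in $\mathrm{Down}(Q)$ admits a sub-sequence $(D_{n})_{n\in N}$, for some infinite $N\subseteq\omega$, which converges to $\bigcup_{n\in N}D_{n}$ in the space $2^{Q}$.
   Context: A quasi-order is a set with a reflexive transitive relation $\leq$. $Q$ is a well-quasi-order (wqo) if there is no bad sequence, i.e. no $f:\omega\to Q$ with $f(m)\not\leq f(n)$ for all $m<n$. $\mathrm{Down}(Q)$ is the set of downsets of $Q$ (subsets $D$ with $q\in D,\ p\leq q\Rightarrow p\in D$). $2^{Q}$ is the product space of copies of the discrete space $\{0,1\}$ indexed by $Q$, identified with the power set of $Q$; $\mathrm{Down}(Q)$ is regarded as a subspace. -}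

module Defs where

open import Level using (0ℓ)
open import Data.Nat using (ℕ; _≤_; _<_)
open import Data.Product using (Σ; ∃; _×_)
open import Relation.Nullary using (¬_)
open import Relation.Unary using (Pred; _∈_)
open import Relation.Binary using (Rel)
open import Function.Bundles using (_⇔_)

Bad : {Q : Set} → Rel Q 0ℓ → (ℕ → Q) → Set
Bad _≼_ f = ∀ m n → m < n → ¬ (f m ≼ f n)

IsWQO : {Q : Set} → Rel Q 0ℓ → Set
IsWQO {Q} _≼_ = ¬ (Σ (ℕ → Q) λ f → Bad _≼_ f)

IsDownset : {Q : Set} → Rel Q 0ℓ → Pred Q 0ℓ → Set
IsDownset _≼_ D = ∀ {p q} → q ∈ D → p ≼ q → p ∈ D

Infinite : Pred ℕ 0ℓ → Set
Infinite N = ∀ m → ∃ λ n → m ≤ n × n ∈ N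

⋃[_]_ : {Q : Set} → Pred ℕ 0ℓ → (ℕ → Pred Q 0ℓ) → Pred Q 0ℓ
⋃[ N ] D = λ q → ∃ λ n → n ∈ N × q ∈ D n

-- The subsequence (D n)_{n ∈ N} converges to U in 2^Q (product of
-- discrete {0,1}): for every coordinate q, eventually along N,
-- membership of q in D n agrees with membership of q in U.
ConvergesAlong : {Q : Set} → Pred ℕ 0ℓ → (ℕ → Pred Q 0ℓ) → Pred Q 0ℓ → Set
ConvergesAlong {Q} N D U =
  ∀ (q : Q) → ∃ λ m → ∀ n → m ≤ n → n ∈ N → ((q ∈ D n) ⇔ (q ∈ U))

-- Backwards, the principal downsets ↓ f n of a bad sequence f have no convergent subsequence:
-- f n lies in the union, so it would eventually lie in ↓ f k for some k > n.
-- Forwards, call an inflationary index sequence s stable if no inflationary refinement s ∘ t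
-- shrinks the union ⋃ₖ D (s k). A stable s converges along its range: a point of the union
-- missing from infinitely many D (s k) would be lost by the refinement to those indices.
-- If no stable s existed, repeatedly refining would lose points q₀, q₁, …, where qⱼ survives
-- to stage j but qᵢ is lost at stage i + 1; as the unions are downsets, qᵢ ≼ qⱼ is impossible
-- for i < j, so (qᵢ) is bad.
module Submission where

open import Defs
open import Level using (0ℓ)
open import Data.Nat using (ℕ; zero; suc; _≤_; _⊔_; _≤′_; ≤′-refl; ≤′-step)
open import Data.Nat.Properties using (≤-refl; ≤-trans; m≤m⊔n; m≤n⊔m; ≤⇒≤′)
open import Data.Product using (Σ; ∃; _×_; _,_; proj₁; proj₂)
open import Data.Empty using (⊥-elim)
open import Function using (id; _∘_)
open import Function.Bundles using (_⇔_; mk⇔; Equivalence)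
open import Relation.Nullary using (¬_; yes; no)
open import Relation.Nullary.Negation using (¬∃⟶∀¬)
open import Relation.Unary using (Pred; _∈_; _∉_; _⊆_)
open import Relation.Binary using (Rel; Reflexive; Transitive)
open import Relation.Binary.PropositionalEquality using (_≡_; refl)
open import Axiom.ExcludedMiddle using (ExcludedMiddle)
open import Axiom.DoubleNegationElimination using (em⇒dne)

¬∀⇒∃¬ : ExcludedMiddle 0ℓ → {A : Set} {B : A → Set} → ¬ (∀ x → B x) → ∃ λ x → ¬ B x
¬∀⇒∃¬ em ¬∀ = dne λ ¬∃¬ → ¬∀ λ x → dne (¬∃⟶∀¬ ¬∃¬ x)
  where dne = em⇒dne em

¬→⇒×¬ : ExcludedMiddle 0ℓ → {A B : Set} → ¬ (A → B) → A × ¬ B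
¬→⇒×¬ em ¬A→B = em⇒dne em (λ ¬a → ¬A→B (⊥-elim ∘ ¬a)) , λ b → ¬A→B λ _ → b

Range : (ℕ → ℕ) → Pred ℕ 0ℓ
Range s n = ∃ λ k → s k ≡ n

Inflationary : (ℕ → ℕ) → Set
Inflationary s = ∀ m → m ≤ s m

EventuallyAlong : Pred ℕ 0ℓ → Pred ℕ 0ℓ → Set
EventuallyAlong N P = ∃ λ m → ∀ n → m ≤ n → n ∈ N → P n

inflationary⇒infinite-range : ∀ {s} → Inflationary s → Infinite (Range s)
inflationary⇒infinite-range {s} s-infl m = s m , s-infl m , m , refl

⋃-downset : {Q : Set} {_≼_ : Rel Q 0ℓ} {D : ℕ → Pred Q 0ℓ} (N : Pred ℕ 0ℓ) →
  (∀ n → IsDownset _≼_ (D n)) → IsDownset _≼_ (⋃[ N ] D)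
⋃-downset N downset (n , n∈N , q∈Dn) p≼q = n , n∈N , downset n q∈Dn p≼q

⋃-range-∘-⊆ : {Q : Set} (D : ℕ → Pred Q 0ℓ) (s t : ℕ → ℕ) →
  ⋃[ Range (s ∘ t) ] D ⊆ ⋃[ Range s ] D
⋃-range-∘-⊆ D s t (n , (k , s[tk]≡n) , q∈Dn) = n , (t k , s[tk]≡n) , q∈Dn

convergesAlong-⋃ : ExcludedMiddle 0ℓ → {Q : Set} (N : Pred ℕ 0ℓ) (D : ℕ → Pred Q 0ℓ) →
  (∀ q → q ∈ ⋃[ N ] D → EventuallyAlong N (λ n → q ∈ D n)) →
  ConvergesAlong N D (⋃[ N ] D)
convergesAlong-⋃ em N D eventually q with em {q ∈ ⋃[ N ] D}
... | yes q∈⋃ = let (m , always) = eventually q q∈⋃ in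
  m , λ n m≤n n∈N → mk⇔ (λ q∈Dn → n , n∈N , q∈Dn) (λ _ → always n m≤n n∈N)
... | no q∉⋃ = 0 , λ n _ n∈N → mk⇔ (λ q∈Dn → ⊥-elim (q∉⋃ (n , n∈N , q∈Dn))) (⊥-elim ∘ q∉⋃)

¬eventually⇒avoiding-refinement : ExcludedMiddle 0ℓ → (s : ℕ → ℕ) (P : Pred ℕ 0ℓ) →
  ¬ EventuallyAlong (Range s) P →
  ∃ λ t → Inflationary (s ∘ t) × ∀ m → ¬ P (s (t m))
¬eventually⇒avoiding-refinement em s P ¬eventually =
  proj₁ ∘ avoid , proj₁ ∘ proj₂ ∘ avoid , proj₂ ∘ proj₂ ∘ avoid
  where
  avoid : ∀ m → ∃ λ k → m ≤ s k × ¬ P (s k)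
  avoid m with ¬∀⇒∃¬ em (λ always → ¬eventually (m , always))
  ... | n , ¬always-n with ¬→⇒×¬ em ¬always-n
  ...   | m≤n , ¬in-range→P with ¬→⇒×¬ em ¬in-range→P
  ...     | (k , refl) , ¬Psk = k , m≤n , ¬Psk

module _ {Q : Set} (D : ℕ → Pred Q 0ℓ) where

  Stable : (ℕ → ℕ) → Set
  Stable s = ∀ t → Inflationary (s ∘ t) → ⋃[ Range s ] D ⊆ ⋃[ Range (s ∘ t) ] D

  stable⇒convergesAlong-range : ExcludedMiddle 0ℓ → ∀ {s} → Stable s →
    ConvergesAlong (Range s) D (⋃[ Range s ] D)
  stable⇒convergesAlong-range em {s} stable = convergesAlong-⋃ em (Range s) D eventually
    where
    eventually : ∀ q → q ∈ ⋃[ Range s ] D → EventuallyAlong (Range s) (λ n → q ∈ D n)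
    eventually q q∈⋃ with em {EventuallyAlong (Range s) (λ n → q ∈ D n)}
    ... | yes ev = ev
    ... | no ¬ev with ¬eventually⇒avoiding-refinement em s (λ n → q ∈ D n) ¬ev
    ...   | t , s∘t-infl , avoid with stable t s∘t-infl q∈⋃
    ...     | _ , (k , refl) , q∈Dn = ⊥-elim (avoid k q∈Dn)

  record ShrinkingRefinement (s : ℕ → ℕ) : Set where
    field
      refinement   : ℕ → ℕ
      inflationary : Inflationary (s ∘ refinement)
      lost         : Q
      lost∈        : lost ∈ ⋃[ Range s ] D
      lost∉        : lost ∉ ⋃[ Range (s ∘ refinement) ] D

  ¬stable⇒shrinkingRefinement : ExcludedMiddle 0ℓ → ∀ {s} → ¬ Stable s → ShrinkingRefinement s
  ¬stable⇒shrinkingRefinement em ¬stable with ¬∀⇒∃¬ em ¬stable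
  ... | t , ¬t-keeps with ¬→⇒×¬ em ¬t-keeps
  ...   | s∘t-infl , ¬⊆ with ¬∀⇒∃¬ em (λ keeps → ¬⊆ λ {q} → keeps q)
  ...     | q , ¬q-kept with ¬→⇒×¬ em ¬q-kept
  ...       | q∈ , q∉ = record
    { refinement = t ; inflationary = s∘t-infl ; lost = q ; lost∈ = q∈ ; lost∉ = q∉ }

  module _ (shrink : ∀ s → Inflationary s → ShrinkingRefinement s) where

    stage : ℕ → Σ (ℕ → ℕ) Inflationary
    stage zero    = id , λ _ → ≤-refl
    stage (suc i) = let (s , s-infl) = stage i ; r = shrink s s-infl in
      s ∘ ShrinkingRefinement.refinement r , ShrinkingRefinement.inflationary r

    ⋃-stage : ℕ → Pred Q 0ℓ
    ⋃-stage i = ⋃[ Range (proj₁ (stage i)) ] D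

    lostAt : ℕ → Q
    lostAt i = ShrinkingRefinement.lost (shrink (proj₁ (stage i)) (proj₂ (stage i)))

    ⋃-stage-antitone : ∀ {i j} → i ≤′ j → ⋃-stage j ⊆ ⋃-stage i
    ⋃-stage-antitone ≤′-refl             = id
    ⋃-stage-antitone (≤′-step {j} i≤′j) =
      ⋃-stage-antitone i≤′j ∘ ⋃-range-∘-⊆ D (proj₁ (stage j)) _

    lostAt-bad : {_≼_ : Rel Q 0ℓ} → (∀ n → IsDownset _≼_ (D n)) → Bad _≼_ lostAt
    lostAt-bad downset i j i<j lostᵢ≼lostⱼ =
      ShrinkingRefinement.lost∉ (shrink (proj₁ (stage i)) (proj₂ (stage i)))
        (⋃-downset _ downset lostⱼ∈ lostᵢ≼lostⱼ)
      where
      lostⱼ∈ : lostAt j ∈ ⋃-stage (suc i)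
      lostⱼ∈ = ⋃-stage-antitone (≤⇒≤′ i<j)
        (ShrinkingRefinement.lost∈ (shrink (proj₁ (stage j)) (proj₂ (stage j))))

  wqo⇒stable : ExcludedMiddle 0ℓ → {_≼_ : Rel Q 0ℓ} → IsWQO _≼_ →
    (∀ n → IsDownset _≼_ (D n)) → ∃ λ s → Inflationary s × Stable s
  wqo⇒stable em wqo downset = em⇒dne em λ ¬∃stable →
    let shrink s s-infl = ¬stable⇒shrinkingRefinement em λ stable → ¬∃stable (s , s-infl , stable)
    in wqo (lostAt shrink , lostAt-bad shrink downset)

convergence⇒wqo : {Q : Set} {_≼_ : Rel Q 0ℓ} → Reflexive _≼_ → Transitive _≼_ →
  ((D : ℕ → Pred Q 0ℓ) → (∀ n → IsDownset _≼_ (D n)) →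
    Σ (Pred ℕ 0ℓ) λ N → Infinite N × ConvergesAlong N D (⋃[ N ] D)) →
  IsWQO _≼_
convergence⇒wqo {_≼_ = _≼_} ≼-refl ≼-trans converges (f , bad)
  with converges (λ n q → q ≼ f n) (λ n q≼fn p≼q → ≼-trans p≼q q≼fn)
... | N , N-inf , conv with N-inf 0
...   | n , _ , n∈N with conv (f n)
...     | m , stays with N-inf (m ⊔ suc n)
...       | k , m⊔sn≤k , k∈N =
  bad n k (≤-trans (m≤n⊔m m (suc n)) m⊔sn≤k)
    (Equivalence.from (stays k (≤-trans (m≤m⊔n m (suc n)) m⊔sn≤k) k∈N) (n , n∈N , ≼-refl))

proposition2p14 : ExcludedMiddle 0ℓ →
    (Q : Set) (_≼_ : Rel Q 0ℓ) → Reflexive _≼_ → Transitive _≼_ →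
    IsWQO _≼_ ⇔
      ((D : ℕ → Pred Q 0ℓ) → (∀ n → IsDownset _≼_ (D n)) →
        Σ (Pred ℕ 0ℓ) λ N → Infinite N × ConvergesAlong N D (⋃[ N ] D))
proposition2p14 em Q _≼_ ≼-refl ≼-trans = mk⇔ wqo⇒convergence (convergence⇒wqo ≼-refl ≼-trans)
  where
  wqo⇒convergence : IsWQO _≼_ → (D : ℕ → Pred Q 0ℓ) → (∀ n → IsDownset _≼_ (D n)) →
    Σ (Pred ℕ 0ℓ) λ N → Infinite N × ConvergesAlong N D (⋃[ N ] D)
  wqo⇒convergence wqo D downset =
    let (s , s-infl , stable) = wqo⇒stable D em wqo downset
    in Range s , inflationary⇒infinite-range s-infl , stable⇒convergesAlong-range D em stable
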